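{- Let $m\ge3$ be an odd integer, let $L$ be the $m\times 2m$ table corresponding to a distance magic labeling $\ell$ of $C_m\square C_{2m}$, and let $T=re(L)=[t_{i,j}]_{0\le i,j<m}$. Then for all $i,j$ with $0\le i,j<m$ and all integers $s$, $$t_{i+1,j}-t_{i,j+\frac{m-1}{2}} = t_{i+1-s,\,j+\frac{m+1}{2}s} - t_{i-s,\,j+\frac{m-1}{2}+\frac{m+1}{2}s},$$ where indices are taken modulo $m$.
   Context: $\mathcal{N}_N=\{1-N,3-N,\ldots,N-1\}$. A distance magic labeling of a graph $\Gamma=(V,E)$ of order $N$ is a bijection $\ell:V\to\mathcal{N}_N$ such that for every vertex the sum of the labels of its neighbours is $0$. $C_m\square C_{2m}$ is the Cayley graph of $\mathbb{Z}_m\times\mathbb{Z}_{2m}$ with connection set $\{\pm(1,0),\pm(0,1)\}$; its labeling $\ell$ is represented by the $m\times 2m$ table $L=[\ell_{i,j}]$, $\ell_{i,j}=\ell((i,j))$, first index modulo $m$, second modulo $2m$. The reduced table $re(L)$ is the $m\times m$ table $[t_{i,j}]$ with $t_{i,j}=\ell_{i,2j}$. -}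

module Defs where

open import Data.Nat as ℕ using (ℕ; zero; suc; NonZero; _<_)
open import Data.Nat.Properties using (m*n≢0)
open import Data.Integer as ℤ using (ℤ; +_; _%ℕ_)
open import Data.Integer.DivMod using (n%ℕd<d)
open import Data.Fin using (Fin; toℕ; fromℕ<)
open import Data.Product using (Σ; _×_; _,_; ∃)
open import Relation.Binary.PropositionalEquality using (_≡_)
open import Function.Definitions using (Injective)

modF : (n : ℕ) → .{{NonZero n}} → ℤ → Fin n
modF n x = fromℕ< (n%ℕd<d x n)

nz2m : (m : ℕ) → .{{NonZero m}} → NonZero (2 ℕ.* m)
nz2m (suc m) = _

Vertex : ℕ → Set
Vertex m = Fin m × Fin (2 ℕ.* m)

InN : ℕ → ℤ → Set
InN N x = Σ ℕ λ k → (k < N) × (x ≡ (+ (2 ℕ.* k ℕ.+ 1)) ℤ.- (+ N))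

IsBijectionOntoN : {V : Set} → ℕ → (V → ℤ) → Set
IsBijectionOntoN {V} N ℓ =
  Injective _≡_ _≡_ ℓ
  × (∀ v → InN N (ℓ v))
  × (∀ x → InN N x → ∃ λ v → ℓ v ≡ x)

entry : (m : ℕ) → .{{NonZero m}} → (Vertex m → ℤ) → ℤ → ℤ → ℤ
entry m ℓ i j = ℓ (modF m i , modF (2 ℕ.* m) {{nz2m m}} j)

-- Distance magic labeling of C_m □ C_{2m} (m ≥ 3, so the four neighbours
-- (i±1,j), (i,j±1) of every vertex are distinct): bijection onto 𝒩_{2m²}
-- and the labels of the neighbours of every vertex sum to 0.
IsDistanceMagicCmC2m : (m : ℕ) → .{{NonZero m}} → (Vertex m → ℤ) → Set
IsDistanceMagicCmC2m m ℓ =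
  IsBijectionOntoN (m ℕ.* (2 ℕ.* m)) ℓ
  × (∀ (i j : ℤ) →
       entry m ℓ (i ℤ.+ ℤ.1ℤ) j ℤ.+ entry m ℓ (i ℤ.- ℤ.1ℤ) j
       ℤ.+ entry m ℓ i (j ℤ.+ ℤ.1ℤ) ℤ.+ entry m ℓ i (j ℤ.- ℤ.1ℤ) ≡ ℤ.0ℤ)

reT : (m : ℕ) → .{{NonZero m}} → (Vertex m → ℤ) → ℤ → ℤ → ℤ
reT m ℓ i j = entry m ℓ i (+ 2 ℤ.* j)

{-# OPTIONS --safe #-}

-- Read the labeling as f = entry m ℓ : ℤ² → ℤ, m-periodic in the first and 2m-periodic
-- in the second index, with zero neighbour sums.  Induction on k gives
-- f(x+k,y) + f(x−k,y) = (−1)ᵏ (f(x,y+k) + f(x,y−k)); at k = m periodicity turns this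
-- into 2 f(x,y) = −2 f(x,y+m), so f(x,y+m) = −f(x,y).  Hence
-- f(x+1,y) − f(x,y+m−1) = f(x+1,y) + f(x,y−1), which by the neighbour sum at (x,y) is
-- −f(x−1,y) − f(x,y+1), i.e. the same difference at (x−1, y+m+1).  Iterating s times and
-- putting y = 2j gives the identity.

module Submission where

open import Defs
open import Data.Nat as ℕ using (ℕ; NonZero; _≤_; _/_; _∸_)
open import Data.Nat.Divisibility using (_∣_; divides)
open import Relation.Nullary using (¬_)
open import Data.Integer as ℤ using (ℤ; +_)
open import Data.Fin using (Fin; toℕ)
open import Relation.Binary.PropositionalEquality using (_≡_)

open import Algebra.Properties.CommutativeSemigroup using (interchange)
open import Data.Fin.Properties using (fromℕ<-cong)
open import Data.Integer using (+[1+_]; -[1+_]; _+_; _-_; _*_; -_; _^_; 0ℤ; 1ℤ; -1ℤ; _%ℕ_; _/ℕ_)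
open import Data.Integer.DivMod using (a≡a%ℕn+[a/ℕn]*n; n%ℕd<d)
open import Data.Integer.Properties
  using (+-injective; +-identityˡ; +-identityʳ; +-comm; *-identityˡ; *-assoc; *-comm; *-distribˡ-+;
         *-cancelˡ-≡; neg-involutive; pos-*; +-commutativeSemigroup)
open import Data.Integer.Tactic.RingSolver using (solve-∀; solve)
open import Data.List using (_∷_; [])
open import Data.Nat.DivMod using (m≡m%n+[m/n]*n; m%n<n; m*n/n≡m)
import Data.Nat.Properties as ℕ
open import Data.Product using (_,_)
open import Relation.Nullary using (contradiction)
open import Relation.Binary.PropositionalEquality using (refl; sym; trans; cong; cong₂; subst; module ≡-Reasoning)

open ≡-Reasoning

symSum : (ℤ → ℤ) → ℤ → ℤ → ℤ
symSum g x k = g (x + k) + g (x - k)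

symSum-zero : ∀ g x → symSum g x 0ℤ ≡ g x + g x
symSum-zero g x = cong (λ x′ → g x′ + g x′) (+-identityʳ x)

symSum-neg : ∀ g x k → symSum g x (- k) ≡ symSum g x k
symSum-neg g x k = begin
  g (x - k) + g (x - - k) ≡⟨ cong (λ k′ → g (x - k) + g (x + k′)) (neg-involutive k) ⟩
  g (x - k) + g (x + k)   ≡⟨ +-comm (g (x - k)) (g (x + k)) ⟩
  symSum g x k            ∎

-- The discrete form of 2 cos a cos b = cos (a + b) + cos (a − b).
symSum-product : ∀ g x a b →
  symSum g (x + a) b + symSum g (x - a) b ≡ symSum g x (a + b) + symSum g x (a - b)
symSum-product g x a b = begin
  (g (x + a + b) + g (x + a - b)) + (g (x - a + b) + g (x - a - b))
    ≡⟨ cong₂ _+_ (cong₂ _+_ (cong g (solve (x ∷ a ∷ b ∷ []))) (cong g (solve (x ∷ a ∷ b ∷ []))))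
                 (cong₂ _+_ (cong g (solve (x ∷ a ∷ b ∷ []))) (cong g (solve (x ∷ a ∷ b ∷ [])))) ⟩
  (g (x + (a + b)) + g (x + (a - b))) + (g (x - (a - b)) + g (x - (a + b)))
    ≡⟨ rearrange (g (x + (a + b))) (g (x + (a - b))) (g (x - (a - b))) (g (x - (a + b))) ⟩
  (g (x + (a + b)) + g (x - (a + b))) + (g (x + (a - b)) + g (x - (a - b))) ∎
  where
  rearrange : ∀ u v w z → (u + v) + (w + z) ≡ (u + z) + (v + w)
  rearrange = solve-∀

symSum-product-1ˡ : ∀ g x k →
  symSum g (x + 1ℤ) (1ℤ + k) + symSum g (x - 1ℤ) (1ℤ + k) ≡ symSum g x (1ℤ + (1ℤ + k)) + symSum g x k
symSum-product-1ˡ g x k = begin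
  symSum g (x + 1ℤ) (1ℤ + k) + symSum g (x - 1ℤ) (1ℤ + k)
    ≡⟨ symSum-product g x 1ℤ (1ℤ + k) ⟩
  symSum g x (1ℤ + (1ℤ + k)) + symSum g x (1ℤ - (1ℤ + k))
    ≡⟨ cong (λ k′ → symSum g x (1ℤ + (1ℤ + k)) + symSum g x k′) (solve (k ∷ [])) ⟩
  symSum g x (1ℤ + (1ℤ + k)) + symSum g x (- k)
    ≡⟨ cong (_+_ (symSum g x (1ℤ + (1ℤ + k)))) (symSum-neg g x k) ⟩
  symSum g x (1ℤ + (1ℤ + k)) + symSum g x k ∎

symSum-product-1ʳ : ∀ g x k →
  symSum g (x + (1ℤ + k)) 1ℤ + symSum g (x - (1ℤ + k)) 1ℤ ≡ symSum g x (1ℤ + (1ℤ + k)) + symSum g x k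
symSum-product-1ʳ g x k = begin
  symSum g (x + (1ℤ + k)) 1ℤ + symSum g (x - (1ℤ + k)) 1ℤ
    ≡⟨ symSum-product g x (1ℤ + k) 1ℤ ⟩
  symSum g x (1ℤ + k + 1ℤ) + symSum g x (1ℤ + k - 1ℤ)
    ≡⟨ cong₂ (λ k₁ k₂ → symSum g x k₁ + symSum g x k₂) (solve (k ∷ [])) (solve (k ∷ [])) ⟩
  symSum g x (1ℤ + (1ℤ + k)) + symSum g x k ∎

NeighbourSumZero : (ℤ → ℤ → ℤ) → Set
NeighbourSumZero f = ∀ x y → f (x + 1ℤ) y + f (x - 1ℤ) y + f x (y + 1ℤ) + f x (y - 1ℤ) ≡ 0ℤ

vSum hSum : (ℤ → ℤ → ℤ) → ℤ → ℤ → ℤ → ℤ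
vSum f x y = symSum (λ x′ → f x′ y) x
hSum f x y = symSum (f x) y

-1^[2+n]≡-1^n : ∀ n → -1ℤ ^ (2 ℕ.+ n) ≡ -1ℤ ^ n
-1^[2+n]≡-1^n n = trans (sym (*-assoc -1ℤ -1ℤ (-1ℤ ^ n))) (*-identityˡ (-1ℤ ^ n))

a+b+c+d≡0⇒a+b≡-1*[c+d] : ∀ a b c d → a + b + c + d ≡ 0ℤ → a + b ≡ -1ℤ * (c + d)
a+b+c+d≡0⇒a+b≡-1*[c+d] a b c d eq = begin
  a + b                               ≡⟨ solve (a ∷ b ∷ c ∷ d ∷ []) ⟩
  (a + b + c + d) + -1ℤ * (c + d)     ≡⟨ cong (_+ -1ℤ * (c + d)) eq ⟩
  0ℤ + -1ℤ * (c + d)                  ≡⟨ +-identityˡ (-1ℤ * (c + d)) ⟩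
  -1ℤ * (c + d)                       ∎

a+b≡s*[c+d]⇒b≡s*d⇒a≡s*c : ∀ s a b c d → a + b ≡ s * (c + d) → b ≡ s * d → a ≡ s * c
a+b≡s*[c+d]⇒b≡s*d⇒a≡s*c s a b c d a+b≡ b≡ = begin
  a                   ≡⟨ solve (a ∷ b ∷ []) ⟩
  a + b - b           ≡⟨ cong₂ _-_ a+b≡ b≡ ⟩
  s * (c + d) - s * d ≡⟨ solve (s ∷ c ∷ d ∷ []) ⟩
  s * c               ∎

module _ {f : ℤ → ℤ → ℤ} (zero-sum : NeighbourSumZero f) where

  vSum≡-hSum : ∀ x y → vSum f x y 1ℤ ≡ -1ℤ * hSum f x y 1ℤ
  vSum≡-hSum x y =
    a+b+c+d≡0⇒a+b≡-1*[c+d] (f (x + 1ℤ) y) (f (x - 1ℤ) y) (f x (y + 1ℤ)) (f x (y - 1ℤ)) (zero-sum x y)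

  VSum≡±HSum : ℕ → Set
  VSum≡±HSum n = ∀ x y → vSum f x y (+ n) ≡ (-1ℤ ^ n) * hSum f x y (+ n)

  vSum≡±hSum-step : ∀ n → VSum≡±HSum n → VSum≡±HSum (ℕ.suc n) →
                    VSum≡±HSum (ℕ.suc (ℕ.suc n))
  vSum≡±hSum-step n ih₀ ih₁ x y = begin
    vSum f x y K₂
      ≡⟨ a+b≡s*[c+d]⇒b≡s*d⇒a≡s*c σ (vSum f x y K₂) (vSum f x y K) (hSum f x y K₂) (hSum f x y K)
                                  vSum-pair (ih₀ x y) ⟩
    σ * hSum f x y K₂
      ≡⟨ cong (_* hSum f x y K₂) (sym (-1^[2+n]≡-1^n n)) ⟩
    (-1ℤ ^ (2 ℕ.+ n)) * hSum f x y K₂ ∎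
    where
    σ = -1ℤ ^ n
    K = + n
    K₁ = 1ℤ + K
    K₂ = 1ℤ + K₁
    flip-signs : ∀ s u v → -1ℤ * s * (-1ℤ * u + -1ℤ * v) ≡ s * (u + v)
    flip-signs = solve-∀
    vSum-pair : vSum f x y K₂ + vSum f x y K ≡ σ * (hSum f x y K₂ + hSum f x y K)
    vSum-pair = begin
      vSum f x y K₂ + vSum f x y K
        ≡⟨ sym (symSum-product-1ˡ (λ x′ → f x′ y) x K) ⟩
      vSum f (x + 1ℤ) y K₁ + vSum f (x - 1ℤ) y K₁
        ≡⟨ cong₂ _+_ (ih₁ (x + 1ℤ) y) (ih₁ (x - 1ℤ) y) ⟩
      -1ℤ * σ * hSum f (x + 1ℤ) y K₁ + -1ℤ * σ * hSum f (x - 1ℤ) y K₁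
        ≡⟨ sym (*-distribˡ-+ (-1ℤ * σ) (hSum f (x + 1ℤ) y K₁) (hSum f (x - 1ℤ) y K₁)) ⟩
      -1ℤ * σ * (hSum f (x + 1ℤ) y K₁ + hSum f (x - 1ℤ) y K₁)
        ≡⟨ cong (-1ℤ * σ *_) (interchange +-commutativeSemigroup
             (f (x + 1ℤ) (y + K₁)) (f (x + 1ℤ) (y - K₁)) (f (x - 1ℤ) (y + K₁)) (f (x - 1ℤ) (y - K₁))) ⟩
      -1ℤ * σ * (vSum f x (y + K₁) 1ℤ + vSum f x (y - K₁) 1ℤ)
        ≡⟨ cong (-1ℤ * σ *_) (cong₂ _+_ (vSum≡-hSum x (y + K₁)) (vSum≡-hSum x (y - K₁))) ⟩
      -1ℤ * σ * (-1ℤ * hSum f x (y + K₁) 1ℤ + -1ℤ * hSum f x (y - K₁) 1ℤ)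
        ≡⟨ flip-signs σ (hSum f x (y + K₁) 1ℤ) (hSum f x (y - K₁) 1ℤ) ⟩
      σ * (hSum f x (y + K₁) 1ℤ + hSum f x (y - K₁) 1ℤ)
        ≡⟨ cong (σ *_) (symSum-product-1ʳ (f x) y K) ⟩
      σ * (hSum f x y K₂ + hSum f x y K) ∎

  vSum≡±hSum : ∀ n → VSum≡±HSum n
  vSum≡±hSum 0 x y = begin
    vSum f x y 0ℤ       ≡⟨ symSum-zero (λ x′ → f x′ y) x ⟩
    f x y + f x y       ≡⟨ sym (symSum-zero (f x) y) ⟩
    hSum f x y 0ℤ       ≡⟨ sym (*-identityˡ (hSum f x y 0ℤ)) ⟩
    1ℤ * hSum f x y 0ℤ  ∎
  vSum≡±hSum 1 = vSum≡-hSum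
  vSum≡±hSum (ℕ.suc (ℕ.suc n)) = vSum≡±hSum-step n (vSum≡±hSum n) (vSum≡±hSum (ℕ.suc n))

Antiperiodic₂ : ℤ → (ℤ → ℤ → ℤ) → Set
Antiperiodic₂ p f = ∀ x y → f x (y + p) ≡ - f x y

u+u≡-1*[v+v]⇒v≡-u : ∀ u v → u + u ≡ -1ℤ * (v + v) → v ≡ - u
u+u≡-1*[v+v]⇒v≡-u u v eq = *-cancelˡ-≡ (+ 2) v (- u) (begin
  + 2 * v            ≡⟨ solve (v ∷ []) ⟩
  - (-1ℤ * (v + v))  ≡⟨ cong -_ (sym eq) ⟩
  - (u + u)          ≡⟨ solve (u ∷ []) ⟩
  + 2 * - u          ∎)

odd-period⇒antiperiodic : ∀ {f p} → NeighbourSumZero f → -1ℤ ^ p ≡ -1ℤ →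
  (∀ x y → f (x + + p) y ≡ f x y) → (∀ x y → f x (y + + (2 ℕ.* p)) ≡ f x y) →
  Antiperiodic₂ (+ p) f
odd-period⇒antiperiodic {f} {p} zero-sum odd periodicˡ periodicʳ x y =
  u+u≡-1*[v+v]⇒v≡-u (f x y) (f x (y + P)) (begin
    f x y + f x y                      ≡⟨ cong₂ _+_ (sym (periodicˡ x y)) (sym periodic-x) ⟩
    vSum f x y P                       ≡⟨ vSum≡±hSum {f} zero-sum p x y ⟩
    (-1ℤ ^ p) * hSum f x y P           ≡⟨ cong₂ _*_ odd (cong (_+_ (f x (y + P))) periodic-y) ⟩
    -1ℤ * (f x (y + P) + f x (y + P))  ∎)
  where
  P = + p
  sub-add : ∀ z q → z - q + q ≡ z
  sub-add = solve-∀
  sub-add-twice : ∀ z q → z - q + + 2 * q ≡ z + q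
  sub-add-twice = solve-∀
  periodic-x : f (x - P) y ≡ f x y
  periodic-x = trans (sym (periodicˡ (x - P) y)) (cong (λ x′ → f x′ y) (sub-add x P))
  periodic-y : f x (y - P) ≡ f x (y + P)
  periodic-y = begin
    f x (y - P)                    ≡⟨ sym (periodicʳ x (y - P)) ⟩
    f x (y - P + + (2 ℕ.* p))      ≡⟨ cong (λ q → f x (y - P + q)) (pos-* 2 p) ⟩
    f x (y - P + + 2 * P)          ≡⟨ cong (f x) (sub-add-twice y P) ⟩
    f x (y + P)                    ∎

antiperiodic⇒periodic : ∀ {f p} → Antiperiodic₂ p f → ∀ x y → f x (y + p + p) ≡ f x y
antiperiodic⇒periodic {f} {p} anti x y = begin
  f x (y + p + p)  ≡⟨ anti x (y + p) ⟩
  - f x (y + p)    ≡⟨ cong -_ (anti x y) ⟩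
  - - f x y        ≡⟨ neg-involutive (f x y) ⟩
  f x y            ∎

-- For p = m and y = 2j this is t(x+1, j) − t(x, j + (m−1)/2).
skewDiff : ℤ → (ℤ → ℤ → ℤ) → ℤ → ℤ → ℤ
skewDiff p f x y = f (x + 1ℤ) y - f x (y + (p - 1ℤ))

skewDiff-step : ∀ {f p} → NeighbourSumZero f → Antiperiodic₂ p f →
                ∀ x y → skewDiff p f x y ≡ skewDiff p f (x - 1ℤ) (y + (p + 1ℤ))
skewDiff-step {f} {p} zero-sum anti x y = begin
  f (x + 1ℤ) y - f x (y + (p - 1ℤ))
    ≡⟨ cong (_-_ (f (x + 1ℤ) y)) (trans (cong (f x) (regroup y p)) (anti x (y - 1ℤ))) ⟩
  f (x + 1ℤ) y - - f x (y - 1ℤ)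
    ≡⟨ rearrange (f (x + 1ℤ) y) (f (x - 1ℤ) y) (f x (y + 1ℤ)) (f x (y - 1ℤ)) (zero-sum x y) ⟩
  - f x (y + 1ℤ) - f (x - 1ℤ) y
    ≡⟨ cong₂ _-_ (sym (anti x (y + 1ℤ))) (sym (antiperiodic⇒periodic anti (x - 1ℤ) y)) ⟩
  f x (y + 1ℤ + p) - f (x - 1ℤ) (y + p + p)
    ≡⟨ cong₂ _-_ (cong₂ f (solve (x ∷ [])) (solve (y ∷ p ∷ []))) (cong (f (x - 1ℤ)) (solve (y ∷ p ∷ []))) ⟩
  f (x - 1ℤ + 1ℤ) (y + (p + 1ℤ)) - f (x - 1ℤ) (y + (p + 1ℤ) + (p - 1ℤ)) ∎
  where
  regroup : ∀ y p → y + (p - 1ℤ) ≡ y - 1ℤ + p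
  regroup = solve-∀
  rearrange : ∀ a b c d → a + b + c + d ≡ 0ℤ → a - - d ≡ - c - b
  rearrange a b c d eq = begin
    a - - d                      ≡⟨ solve (a ∷ b ∷ c ∷ d ∷ []) ⟩
    (a + b + c + d) - c - b      ≡⟨ cong (λ z → z - c - b) eq ⟩
    0ℤ - c - b                   ≡⟨ cong (_- b) (+-identityˡ (- c)) ⟩
    - c - b                      ∎

translation-invariant : ∀ {A : Set} (h : ℤ → ℤ → A) d → (∀ x y → h x y ≡ h (x - 1ℤ) (y + d)) →
                        ∀ s x y → h x y ≡ h (x - s) (y + d * s)
translation-invariant h d step = invariant
  where
  invariantℕ : ∀ n x y → h x y ≡ h (x - + n) (y + d * + n)
  invariantℕ 0 x y = cong₂ h (sym (+-identityʳ x)) (solve (y ∷ d ∷ []))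
  invariantℕ (ℕ.suc n) x y = begin
    h x y                                ≡⟨ invariantℕ n x y ⟩
    h (x - + n) (y + d * + n)            ≡⟨ step (x - + n) (y + d * + n) ⟩
    h (x - + n - 1ℤ) (y + d * + n + d)   ≡⟨ cong₂ h (one-more x (+ n)) (one-more′ y d (+ n)) ⟩
    h (x - (1ℤ + + n)) (y + d * (1ℤ + + n)) ∎
    where
    one-more : ∀ x k → x - k - 1ℤ ≡ x - (1ℤ + k)
    one-more = solve-∀
    one-more′ : ∀ y d k → y + d * k + d ≡ y + d * (1ℤ + k)
    one-more′ = solve-∀
  invariant : ∀ s x y → h x y ≡ h (x - s) (y + d * s)
  invariant (+ n) = invariantℕ n
  invariant -[1+ n ] x y = sym (begin
    h (x - - k) (y + d * - k)                ≡⟨ invariantℕ (ℕ.suc n) (x - - k) (y + d * - k) ⟩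
    h (x - - k - k) (y + d * - k + d * k)    ≡⟨ cong₂ h (back x k) (back′ y d k) ⟩
    h x y                                    ∎)
    where
    k = +[1+ n ]
    back : ∀ x k → x - - k - k ≡ x
    back = solve-∀
    back′ : ∀ y d k → y + d * - k + d * k ≡ y
    back′ = solve-∀

reducedDifference-invariant : ∀ {f a} → NeighbourSumZero f → Antiperiodic₂ (1ℤ + + 2 * a) f →
  ∀ s x y → f (x + 1ℤ) (+ 2 * y) - f x (+ 2 * (y + a))
          ≡ f (x + 1ℤ - s) (+ 2 * (y + (1ℤ + a) * s)) - f (x - s) (+ 2 * (y + a + (1ℤ + a) * s))
reducedDifference-invariant {f} {a} zero-sum anti s x y = begin
  f (x + 1ℤ) (+ 2 * y) - f x (+ 2 * (y + a))
    ≡⟨ cong (λ y′ → f (x + 1ℤ) (+ 2 * y) - f x y′) (double-shift y a) ⟩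
  skewDiff p f x (+ 2 * y)
    ≡⟨ translation-invariant (skewDiff p f) (p + 1ℤ) (skewDiff-step zero-sum anti) s x (+ 2 * y) ⟩
  skewDiff p f (x - s) (+ 2 * y + (p + 1ℤ) * s)
    ≡⟨ cong₂ (λ x′ y′ → f x′ y′ - f (x - s) (+ 2 * y + (p + 1ℤ) * s + (p - 1ℤ)))
             (solve (x ∷ s ∷ [])) (double-step y a s) ⟩
  f (x + 1ℤ - s) (+ 2 * (y + (1ℤ + a) * s)) - f (x - s) (+ 2 * y + (p + 1ℤ) * s + (p - 1ℤ))
    ≡⟨ cong (λ y′ → f (x + 1ℤ - s) (+ 2 * (y + (1ℤ + a) * s)) - f (x - s) y′)
            (double-step-shift y a s) ⟩
  f (x + 1ℤ - s) (+ 2 * (y + (1ℤ + a) * s)) - f (x - s) (+ 2 * (y + a + (1ℤ + a) * s)) ∎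
  where
  p = 1ℤ + + 2 * a
  double-shift : ∀ y a → + 2 * (y + a) ≡ + 2 * y + (1ℤ + + 2 * a - 1ℤ)
  double-shift = solve-∀
  double-step : ∀ y a s → + 2 * y + (1ℤ + + 2 * a + 1ℤ) * s ≡ + 2 * (y + (1ℤ + a) * s)
  double-step = solve-∀
  double-step-shift : ∀ y a s →
    + 2 * y + (1ℤ + + 2 * a + 1ℤ) * s + (1ℤ + + 2 * a - 1ℤ) ≡ + 2 * (y + a + (1ℤ + a) * s)
  double-step-shift = solve-∀

r≡r′+[1+k]*d⇒d≤r : ∀ {d r r′} k → + r ≡ + r′ + +[1+ k ] * + d → d ℕ.≤ r
r≡r′+[1+k]*d⇒d≤r {d} {r} {r′} k eq =
  subst (d ℕ.≤_) (+-injective (trans (cong (_+_ (+ r′)) (pos-* (ℕ.suc k) d)) (sym eq)))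
        (ℕ.≤-trans (ℕ.m≤n*m d (ℕ.suc k)) (ℕ.m≤n+m _ r′))

a≡b+e*c⇒b≡a+[-e]*c : ∀ {a b} e c → a ≡ b + e * c → b ≡ a + (- e) * c
a≡b+e*c⇒b≡a+[-e]*c {a} {b} e c eq = begin
  b                     ≡⟨ solve (b ∷ e ∷ c ∷ []) ⟩
  b + e * c + - e * c   ≡⟨ cong (_+ - e * c) (sym eq) ⟩
  a + - e * c           ∎

remainder-unique : ∀ {d r₁ r₂} e → r₁ ℕ.< d → r₂ ℕ.< d → + r₁ ≡ + r₂ + e * + d → r₁ ≡ r₂
remainder-unique (+ 0)    _    _    eq = +-injective (trans eq (+-identityʳ _))
remainder-unique +[1+ k ] r₁<d _    eq = contradiction (r≡r′+[1+k]*d⇒d≤r k eq) (ℕ.<⇒≱ r₁<d)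
remainder-unique {d} -[1+ k ] r₁<d r₂<d eq =
  sym (remainder-unique +[1+ k ] r₂<d r₁<d (a≡b+e*c⇒b≡a+[-e]*c -[1+ k ] (+ d) eq))

remainder-shift : ∀ x n r₁ q₁ r₂ q₂ → x + n ≡ r₁ + q₁ * n → x ≡ r₂ + q₂ * n →
                  r₁ ≡ r₂ + (q₂ + 1ℤ - q₁) * n
remainder-shift x n r₁ q₁ r₂ q₂ x+n≡ x≡ = begin
  r₁                       ≡⟨ solve (r₁ ∷ q₁ ∷ n ∷ []) ⟩
  r₁ + q₁ * n - q₁ * n     ≡⟨ cong (_- q₁ * n) (sym x+n≡) ⟩
  x + n - q₁ * n           ≡⟨ cong (λ x′ → x′ + n - q₁ * n) x≡ ⟩
  r₂ + q₂ * n + n - q₁ * n ≡⟨ solve (r₂ ∷ q₁ ∷ q₂ ∷ n ∷ []) ⟩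
  r₂ + (q₂ + 1ℤ - q₁) * n  ∎

%ℕ-periodic : ∀ n .{{_ : NonZero n}} x → (x + + n) %ℕ n ≡ x %ℕ n
%ℕ-periodic n x = remainder-unique (q₂ + 1ℤ - q₁) (n%ℕd<d (x + + n) n) (n%ℕd<d x n)
  (remainder-shift x (+ n) r₁ q₁ r₂ q₂ (a≡a%ℕn+[a/ℕn]*n (x + + n) n) (a≡a%ℕn+[a/ℕn]*n x n))
  where
  r₁ = + ((x + + n) %ℕ n)
  q₁ = (x + + n) /ℕ n
  r₂ = + (x %ℕ n)
  q₂ = x /ℕ n

modF-periodic : ∀ n .{{_ : NonZero n}} x → modF n (x + + n) ≡ modF n x
modF-periodic n x = fromℕ<-cong _ _ (%ℕ-periodic n x) _ _

entry-periodicˡ : ∀ m .{{_ : NonZero m}} ℓ x y → entry m ℓ (x + + m) y ≡ entry m ℓ x y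
entry-periodicˡ m ℓ x y = cong (λ i → ℓ (i , modF (2 ℕ.* m) {{nz2m m}} y)) (modF-periodic m x)

entry-periodicʳ : ∀ m .{{_ : NonZero m}} ℓ x y → entry m ℓ x (y + + (2 ℕ.* m)) ≡ entry m ℓ x y
entry-periodicʳ m ℓ x y = cong (λ j → ℓ (modF m x , j)) (modF-periodic (2 ℕ.* m) {{nz2m m}} y)

odd⇒≡1+[m/2]*2 : ∀ {m} → ¬ (2 ∣ m) → m ≡ ℕ.suc (m / 2 ℕ.* 2)
odd⇒≡1+[m/2]*2 {m} m-odd with m ℕ.% 2 | m≡m%n+[m/n]*n m 2 | m%n<n m 2
... | 0                 | m≡[m/2]*2   | _ = contradiction (divides (m / 2) m≡[m/2]*2) m-odd
... | 1                 | m≡1+[m/2]*2 | _ = m≡1+[m/2]*2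
... | ℕ.suc (ℕ.suc _)   | _           | ℕ.s≤s (ℕ.s≤s ())

-1^[1+h*2]≡-1 : ∀ h → -1ℤ ^ ℕ.suc (h ℕ.* 2) ≡ -1ℤ
-1^[1+h*2]≡-1 0         = refl
-1^[1+h*2]≡-1 (ℕ.suc h) = trans (-1^[2+n]≡-1^n (ℕ.suc (h ℕ.* 2))) (-1^[1+h*2]≡-1 h)

odd⇒[m∸1]/2≡m/2 : ∀ {m} → ¬ (2 ∣ m) → (m ∸ 1) / 2 ≡ m / 2
odd⇒[m∸1]/2≡m/2 {m} m-odd =
  trans (cong (λ n → (n ∸ 1) / 2) (odd⇒≡1+[m/2]*2 m-odd)) (m*n/n≡m (m / 2) 2)

odd⇒[m+1]/2≡1+m/2 : ∀ {m} → ¬ (2 ∣ m) → (m ℕ.+ 1) / 2 ≡ ℕ.suc (m / 2)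
odd⇒[m+1]/2≡1+m/2 {m} m-odd = begin
  (m ℕ.+ 1) / 2                      ≡⟨ cong (λ n → (n ℕ.+ 1) / 2) (odd⇒≡1+[m/2]*2 m-odd) ⟩
  (ℕ.suc (m / 2 ℕ.* 2) ℕ.+ 1) / 2    ≡⟨ cong (_/ 2) (ℕ.+-comm (ℕ.suc (m / 2 ℕ.* 2)) 1) ⟩
  ℕ.suc (m / 2) ℕ.* 2 / 2            ≡⟨ m*n/n≡m (ℕ.suc (m / 2)) 2 ⟩
  ℕ.suc (m / 2)                      ∎

odd⇒-1^m≡-1 : ∀ {m} → ¬ (2 ∣ m) → -1ℤ ^ m ≡ -1ℤ
odd⇒-1^m≡-1 {m} m-odd =
  subst (λ n → -1ℤ ^ n ≡ -1ℤ) (sym (odd⇒≡1+[m/2]*2 m-odd)) (-1^[1+h*2]≡-1 (m / 2))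

odd⇒+m≡1+2*[m/2] : ∀ {m} → ¬ (2 ∣ m) → + m ≡ 1ℤ + + 2 * + (m / 2)
odd⇒+m≡1+2*[m/2] {m} m-odd = begin
  + m                      ≡⟨ cong +_ (odd⇒≡1+[m/2]*2 m-odd) ⟩
  1ℤ + + (m / 2 ℕ.* 2)     ≡⟨ cong (_+_ 1ℤ) (pos-* (m / 2) 2) ⟩
  1ℤ + + (m / 2) * + 2     ≡⟨ cong (_+_ 1ℤ) (*-comm (+ (m / 2)) (+ 2)) ⟩
  1ℤ + + 2 * + (m / 2)     ∎

entry-antiperiodic : ∀ m .{{_ : NonZero m}} ℓ → ¬ (2 ∣ m) → NeighbourSumZero (entry m ℓ) →
                     Antiperiodic₂ (1ℤ + + 2 * + (m / 2)) (entry m ℓ)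
entry-antiperiodic m ℓ m-odd zero-sum =
  subst (λ p → Antiperiodic₂ p (entry m ℓ)) (odd⇒+m≡1+2*[m/2] m-odd)
    (odd-period⇒antiperiodic zero-sum (odd⇒-1^m≡-1 m-odd) (entry-periodicˡ m ℓ) (entry-periodicʳ m ℓ))

lemma3p4 : (m : ℕ) → .{{_ : NonZero m}} → 3 ≤ m → ¬ (2 ∣ m) →
    (ℓ : Vertex m → ℤ) → IsDistanceMagicCmC2m m ℓ →
    (i j : Fin m) (s : ℤ) →
    let I = + toℕ i
        J = + toℕ j
        a = + ((m ∸ 1) / 2)
        b = + ((m ℕ.+ 1) / 2)
    in reT m ℓ (I ℤ.+ ℤ.1ℤ) J ℤ.- reT m ℓ I (J ℤ.+ a)
       ≡ reT m ℓ (I ℤ.+ ℤ.1ℤ ℤ.- s) (J ℤ.+ b ℤ.* s)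
         ℤ.- reT m ℓ (I ℤ.- s) (J ℤ.+ a ℤ.+ b ℤ.* s)
lemma3p4 m _ m-odd ℓ (_ , zero-sum) i j s
  rewrite odd⇒[m∸1]/2≡m/2 m-odd | odd⇒[m+1]/2≡1+m/2 m-odd =
  reducedDifference-invariant {entry m ℓ} {+ (m / 2)} zero-sum (entry-antiperiodic m ℓ m-odd zero-sum)
                              s (+ toℕ i) (+ toℕ j)
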